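{- Let $X$ be a finite connected undirected graph and let $\alpha:\mathbb{E}(\tilde X)\to\mathbb{Z}_p$ be a voltage assignment. For $n\ge0$ let $\alpha_n$ be the composite $\mathbb{E}(\tilde X)\xrightarrow{\alpha}\mathbb{Z}_p\to\mathbb{Z}/p^n\mathbb{Z}$ and $X_n=X(\mathbb{Z}/p^n\mathbb{Z},\alpha_n)$. Then for each fixed $n\ge0$ there is a voltage assignment $\beta:\mathbb{E}(\tilde X_n)\to p^n\mathbb{Z}_p$ such that for every integer $m\ge n$, $X_m$ is isomorphic to the derived graph $X_n(\mathbb{Z}/p^{m-n}\mathbb{Z},\beta_m)$, where $\beta_m$ is the composite $\mathbb{E}(\tilde X_n)\xrightarrow{\beta}p^n\mathbb{Z}_p\to p^n\mathbb{Z}_p/p^m\mathbb{Z}_p\cong\mathbb{Z}/p^{m-n}\mathbb{Z}$.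
   Context: Graphs may have loops and multiple edges. For an undirected graph $X$, $\tilde X$ is the directed graph with the same vertices obtained by replacing each edge by two oppositely directed edges. A $G$-valued voltage assignment on a directed graph is a function on its edges with values in $G$; on an undirected graph $X$ it is one on $\tilde X$ compatible with inversion of edges. The derived graph $X(G,\alpha)$ has vertices $\mathbb{V}(X)\times G$ and edges $\mathbb{E}(\tilde X)\times G$, the edge $(e,\sigma)$ going from $(s,\sigma)$ to $(t,\sigma+\alpha(e))$ if $e$ goes from $s$ to $t$ (written additively for abelian $G$); for undirected $X$ opposite edges are then identified to give an undirected graph. -}

module Defs where

open import Data.Nat using (ℕ; zero; suc; _+_; _∸_; _^_; NonZero; _/_; _%_)
open import Data.Nat.DivMod using (_mod_)
open import Data.Nat.Properties using (m^n≢0)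
open import Data.Fin using (Fin; toℕ)
open import Data.Product using (_×_; _,_; Σ)
open import Function.Bundles using (_↔_; Inverse)
open import Relation.Binary.PropositionalEquality using (_≡_; _≢_)

record Graph : Set₁ where
  field
    V   : Set
    E   : Set
    src : E → V
    tgt : E → V
    inv : E → E
open Graph public

-- Axioms making a Graph the doubled directed graph X~ of an undirected graph X
-- (loops and multiple edges allowed): inv is a fixed-point-free involution
-- reversing edges.
record IsUndirected (X : Graph) : Set where
  field
    inv-inv  : ∀ e → inv X (inv X e) ≡ e
    inv-src  : ∀ e → src X (inv X e) ≡ tgt X e
    inv-tgt  : ∀ e → tgt X (inv X e) ≡ src X e
    inv-free : ∀ e → inv X e ≢ e

IsFinite : Graph → Set
IsFinite X = Σ ℕ (λ a → (V X ↔ Fin a)) × Σ ℕ (λ b → (E X ↔ Fin b))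

data Walk (X : Graph) : V X → V X → Set where
  here : ∀ {v} → Walk X v v
  step : ∀ {v} (e : E X) → Walk X (tgt X e) v → Walk X (src X e) v

Connected : Graph → Set
Connected X = ∀ (u v : V X) → Walk X u v

addMod : ∀ (N : ℕ) .{{_ : NonZero N}} → Fin N → Fin N → Fin N
addMod N a b = (toℕ a + toℕ b) mod N

-- ℤ_p as the inverse limit of ℤ/p^k: compatible sequences of residues.
powNZ : ∀ p k .{{_ : NonZero p}} → NonZero (p ^ k)
powNZ p k = m^n≢0 p k

record ℤₚ (p : ℕ) .{{_ : NonZero p}} : Set where
  field
    res    : (k : ℕ) → Fin (p ^ k)
    compat : ∀ k → toℕ (res k) ≡ _%_ (toℕ (res (suc k))) (p ^ k) {{powNZ p k}}
open ℤₚ public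

-- y = - x in ℤ_p  (checked at every finite level)
IsNeg : ∀ {p} .{{_ : NonZero p}} → ℤₚ p → ℤₚ p → Set
IsNeg {p} y x = ∀ k → toℕ (addMod (p ^ k) {{powNZ p k}} (res y k) (res x k)) ≡ 0

InPowIdeal : ∀ {p} .{{_ : NonZero p}} → ℕ → ℤₚ p → Set
InPowIdeal n x = toℕ (res x n) ≡ 0

IsZpVoltage : ∀ {p} .{{_ : NonZero p}} (X : Graph) → (E X → ℤₚ p) → Set
IsZpVoltage X α = ∀ e → IsNeg (α (inv X e)) (α e)

derived : (X : Graph) (N : ℕ) .{{_ : NonZero N}} → (E X → Fin N) → Graph
derived X N α = record
  { V   = V X × Fin N
  ; E   = E X × Fin N
  ; src = λ { (e , σ) → (src X e , σ) }
  ; tgt = λ { (e , σ) → (tgt X e , addMod N σ (α e)) }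
  ; inv = λ { (e , σ) → (inv X e , addMod N σ (α e)) }
  }

reduce : ∀ {p} .{{_ : NonZero p}} {A : Set} → (A → ℤₚ p) → (n : ℕ) → A → Fin (p ^ n)
reduce α n e = res (α e) n

layer : ∀ (p : ℕ) .{{_ : NonZero p}} (X : Graph) → (E X → ℤₚ p) → ℕ → Graph
layer p X α n = derived X (p ^ n) {{powNZ p n}} (reduce α n)

-- β_m : composite E → p^nℤ_p → p^nℤ_p / p^mℤ_p ≅ ℤ/p^(m-n),
-- the isomorphism being  p^n y ↦ y mod p^(m-n).
reduceShift : ∀ (p : ℕ) .{{_ : NonZero p}} {A : Set} → (A → ℤₚ p) → (n m : ℕ) → A → Fin (p ^ (m ∸ n))
reduceShift p β n m e = _mod_ (_/_ (toℕ (res (β e) m)) (p ^ n) {{powNZ p n}}) (p ^ (m ∸ n)) {{powNZ p (m ∸ n)}}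

record GraphIso (X Y : Graph) : Set where
  field
    onV : V X ↔ V Y
    onE : E X ↔ E Y
    pres-src : ∀ e → Inverse.to onV (src X e) ≡ src Y (Inverse.to onE e)
    pres-tgt : ∀ e → Inverse.to onV (tgt X e) ≡ tgt Y (Inverse.to onE e)
    pres-inv : ∀ e → Inverse.to onE (inv X e) ≡ inv Y (Inverse.to onE e)

-- Write a residue τ modulo p^m in base p^n: a low digit τ mod p^n and a high digit
-- ⌊τ / p^n⌋ mod p^(m−n). Adding a = α_m(e) to τ adds α_n(e) to the low digit and
-- adds to the high digit the carry ⌊(τ mod p^n + a) / p^n⌋, which depends only on
-- the edge (e, τ mod p^n) of X_n. So X_m is derived from X_n with the voltage
-- β(e, σ) = p^n ⌊(σ + α(e)) / p^n⌋ = σ + α(e) − ((σ + α(e)) mod p^n) ∈ p^n ℤ_p,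
-- whose image in p^n ℤ_p / p^m ℤ_p ≅ ℤ/p^(m−n) is that carry. It is a voltage
-- assignment: σ + α(e) mod p^n is the low digit σ′ at the other end of the edge,
-- and σ′ + α(ē) ≡ σ mod p^n, so β(e, σ) + β(ē, σ′) = α(e) + α(ē) = 0.
module Submission where

open import Defs
open import Data.Nat using (ℕ; NonZero; _≤_; _^_; _∸_; suc; zero; _+_; _*_; _/_; _%_)
open import Data.Nat.Primality using (Prime)
open import Data.Product using (Σ; _×_; _,_)
open import Data.Nat.Properties
  using (+-comm; +-monoˡ-≤; m∸n≤m; +-cancelʳ-≡; m*n≢0; ^-distribˡ-+-*; m∸n+n≡m; m≤n+m; m≤m+n; n≤1+n; ≤-reflexive)
open import Data.Nat.DivMod
open import Data.Nat.Divisibility using (_∣_; divides; n∣m*n; ∣-trans; n∣m⇒m%n≡0; m%n≡0⇒n∣m)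
open import Data.Nat.Tactic.RingSolver using (solve-∀)
open import Data.Fin using (Fin; toℕ; combine; remQuot; quotient; remainder)
open import Data.Fin.Properties using (toℕ-injective; toℕ-fromℕ<; toℕ<n; toℕ-combine; combine-remQuot; remQuot-combine)
open import Function.Bundles using (_↔_; mk↔ₛ′)
open import Relation.Binary.PropositionalEquality
open ≡-Reasoning

toℕ-mod : ∀ m n .{{_ : NonZero n}} → toℕ (m mod n) ≡ m % n
toℕ-mod m n = toℕ-fromℕ< (m%n<n m n)

[m+n%d]%d≡[m+n]%d : ∀ m n d .{{_ : NonZero d}} → (m + n % d) % d ≡ (m + n) % d
[m+n%d]%d≡[m+n]%d m n d = begin
  (m + n % d) % d         ≡⟨ %-distribˡ-+ m (n % d) d ⟩
  (m % d + n % d % d) % d ≡⟨ cong (λ t → (m % d + t) % d) (m%n%n≡m%n n d) ⟩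
  (m % d + n % d) % d     ≡⟨ %-distribˡ-+ m n d ⟨
  (m + n) % d             ∎

m%d≡n%d⇒[m*o]%d≡[n*o]%d : ∀ {m n} o d .{{_ : NonZero d}} → m % d ≡ n % d → (m * o) % d ≡ (n * o) % d
m%d≡n%d⇒[m*o]%d≡[n*o]%d {m} {n} o d eq = begin
  (m * o) % d           ≡⟨ %-distribˡ-* m o d ⟩
  (m % d * (o % d)) % d ≡⟨ cong (λ t → (t * (o % d)) % d) eq ⟩
  (n % d * (o % d)) % d ≡⟨ %-distribˡ-* n o d ⟨
  (n * o) % d           ∎

[m+n]/d≡m/d+[m%d+n]/d : ∀ m n d .{{_ : NonZero d}} → (m + n) / d ≡ m / d + (m % d + n) / d
[m+n]/d≡m/d+[m%d+n]/d m n d = begin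
  (m + n) / d                     ≡⟨ /-congˡ (cong (_+ n) (m≡m%n+[m/n]*n m d)) ⟩
  (m % d + m / d * d + n) / d     ≡⟨ /-congˡ (rearrange (m % d) (m / d * d) n) ⟩
  (m / d * d + (m % d + n)) / d   ≡⟨ +-distrib-/-∣ˡ (m % d + n) (n∣m*n (m / d)) ⟩
  m / d * d / d + (m % d + n) / d ≡⟨ cong (_+ (m % d + n) / d) (m*n/n≡m (m / d) d) ⟩
  m / d + (m % d + n) / d         ∎
  where
  rearrange : ∀ a b c → a + b + c ≡ b + (a + c)
  rearrange = solve-∀

m%n/o≡m/o%k : ∀ m {n k o} .{{_ : NonZero n}} .{{_ : NonZero k}} .{{_ : NonZero o}} →
              n ≡ k * o → m % n / o ≡ m / o % k
m%n/o≡m/o%k m {k = k} {o} refl = m%[n*o]/o≡m/o%n m k o {{_}} {{_}} {{m*n≢0 k o}}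

/-%-cong : ∀ {m n M} k d .{{_ : NonZero M}} .{{_ : NonZero k}} .{{_ : NonZero d}} →
           M ≡ k * d → m % M ≡ n % M → m / d % k ≡ n / d % k
/-%-cong {m} {n} k d M≡kd eq = begin
  m / d % k ≡⟨ m%n/o≡m/o%k m M≡kd ⟨
  m % _ / d ≡⟨ cong (_/ d) eq ⟩
  n % _ / d ≡⟨ m%n/o≡m/o%k n M≡kd ⟩
  n / d % k ∎

[m+n]%M/d≡[m/d+[m%d+n]/d%k]%k : ∀ m n {M} k d .{{_ : NonZero M}} .{{_ : NonZero k}} .{{_ : NonZero d}} →
  M ≡ k * d → (m + n) % M / d ≡ (m / d + (m % d + n) / d % k) % k
[m+n]%M/d≡[m/d+[m%d+n]/d%k]%k m n k d M≡kd = begin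
  (m + n) % _ / d                   ≡⟨ m%n/o≡m/o%k (m + n) M≡kd ⟩
  (m + n) / d % k                   ≡⟨ %-congˡ ([m+n]/d≡m/d+[m%d+n]/d m n d) ⟩
  (m / d + (m % d + n) / d) % k     ≡⟨ [m+n%d]%d≡[m+n]%d (m / d) ((m % d + n) / d) k ⟨
  (m / d + (m % d + n) / d % k) % k ∎

+-cancel-cross : ∀ a b s t u v → a + s ≡ t + u → b + t ≡ s + v → a + b ≡ u + v
+-cancel-cross a b s t u v as≡tu bt≡sv = +-cancelʳ-≡ (s + t) (a + b) (u + v) (begin
  a + b + (s + t)   ≡⟨ interchange a b s t ⟩
  (a + s) + (b + t) ≡⟨ cong₂ _+_ as≡tu bt≡sv ⟩
  (t + u) + (s + v) ≡⟨ regroup t u s v ⟩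
  u + v + (s + t)        ∎)
  where
  interchange : ∀ a b s t → a + b + (s + t) ≡ (a + s) + (b + t)
  interchange = solve-∀
  regroup : ∀ t u s v → (t + u) + (s + v) ≡ u + v + (s + t)
  regroup = solve-∀

module Digits {K N : ℕ} .{{_ : NonZero N}} where

  lowDigit : Fin (K * N) → Fin N
  lowDigit = remainder {K} N

  highDigit : Fin (K * N) → Fin K
  highDigit = quotient N

  toℕ-remQuot : (i : Fin (K * N)) → toℕ i ≡ toℕ (lowDigit i) + toℕ (highDigit i) * N
  toℕ-remQuot i = begin
    toℕ i                                    ≡⟨ cong toℕ (combine-remQuot {K} N i) ⟨
    toℕ (combine (highDigit i) (lowDigit i)) ≡⟨ toℕ-combine (highDigit i) (lowDigit i) ⟩
    N * toℕ (highDigit i) + toℕ (lowDigit i) ≡⟨ reorder N (toℕ (highDigit i)) (toℕ (lowDigit i)) ⟩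
    toℕ (lowDigit i) + toℕ (highDigit i) * N ∎
    where
    reorder : ∀ n q r → n * q + r ≡ r + q * n
    reorder = solve-∀

  toℕ-lowDigit : (i : Fin (K * N)) → toℕ (lowDigit i) ≡ toℕ i % N
  toℕ-lowDigit i = sym (begin
    toℕ i % N                                      ≡⟨ %-congˡ (toℕ-remQuot i) ⟩
    (toℕ (lowDigit i) + toℕ (highDigit i) * N) % N ≡⟨ [m+kn]%n≡m%n _ (toℕ (highDigit i)) N ⟩
    toℕ (lowDigit i) % N                           ≡⟨ m<n⇒m%n≡m (toℕ<n (lowDigit i)) ⟩
    toℕ (lowDigit i)                               ∎)

  toℕ-highDigit : (i : Fin (K * N)) → toℕ (highDigit i) ≡ toℕ i / N
  toℕ-highDigit i = sym (begin
    toℕ i / N                                      ≡⟨ /-congˡ (toℕ-remQuot i) ⟩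
    (toℕ (lowDigit i) + toℕ (highDigit i) * N) / N ≡⟨ +-distrib-/-∣ʳ _ (n∣m*n (toℕ (highDigit i))) ⟩
    toℕ (lowDigit i) / N + toℕ (highDigit i) * N / N
      ≡⟨ cong₂ _+_ (m<n⇒m/n≡0 (toℕ<n (lowDigit i))) (m*n/n≡m (toℕ (highDigit i)) N) ⟩
    toℕ (highDigit i)                              ∎)

  splitDigits : {A : Set} → (A × Fin (K * N)) ↔ ((A × Fin N) × Fin K)
  splitDigits = mk↔ₛ′
    (λ (x , i) → (x , lowDigit i) , highDigit i)
    (λ ((x , r) , q) → x , combine q r)
    (λ ((x , r) , q) → cong (λ (q′ , r′) → (x , r′) , q′) (remQuot-combine {K} q r))
    (λ (x , i) → cong (x ,_) (combine-remQuot {K} N i))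

  remQuot-addMod : .{{_ : NonZero K}} .{{_ : NonZero (K * N)}} (i j : Fin (K * N)) (r : Fin N) (c : Fin K) →
    toℕ r ≡ toℕ j % N → toℕ c ≡ (toℕ (lowDigit i) + toℕ j) / N % K →
    remQuot {K} N (addMod (K * N) i j) ≡ (addMod K (highDigit i) c , addMod N (lowDigit i) r)
  remQuot-addMod i j r c r≡j%N c≡carry = cong₂ _,_ (toℕ-injective high-eq) (toℕ-injective low-eq)
    where
    high-eq : toℕ (highDigit (addMod (K * N) i j)) ≡ toℕ (addMod K (highDigit i) c)
    high-eq = begin
      toℕ (highDigit (addMod (K * N) i j)) ≡⟨ toℕ-highDigit _ ⟩
      toℕ (addMod (K * N) i j) / N         ≡⟨ cong (_/ N) (toℕ-mod _ (K * N)) ⟩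
      (toℕ i + toℕ j) % (K * N) / N        ≡⟨ [m+n]%M/d≡[m/d+[m%d+n]/d%k]%k (toℕ i) (toℕ j) K N refl ⟩
      (toℕ i / N + (toℕ i % N + toℕ j) / N % K) % K
        ≡⟨ cong₂ (λ a b → (a + b) % K) (toℕ-highDigit i)
                 (trans c≡carry (cong (λ t → (t + toℕ j) / N % K) (toℕ-lowDigit i))) ⟨
      (toℕ (highDigit i) + toℕ c) % K      ≡⟨ toℕ-mod _ K ⟨
      toℕ (addMod K (highDigit i) c)       ∎
    low-eq : toℕ (lowDigit (addMod (K * N) i j)) ≡ toℕ (addMod N (lowDigit i) r)
    low-eq = begin
      toℕ (lowDigit (addMod (K * N) i j)) ≡⟨ toℕ-lowDigit _ ⟩
      toℕ (addMod (K * N) i j) % N        ≡⟨ cong (_% N) (toℕ-mod _ (K * N)) ⟩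
      (toℕ i + toℕ j) % (K * N) % N       ≡⟨ m∣n⇒o%n%m≡o%m N (K * N) _ (n∣m*n K) ⟩
      (toℕ i + toℕ j) % N                 ≡⟨ %-distribˡ-+ (toℕ i) (toℕ j) N ⟩
      (toℕ i % N + toℕ j % N) % N         ≡⟨ cong₂ (λ a b → (a + b) % N) (toℕ-lowDigit i) r≡j%N ⟨
      (toℕ (lowDigit i) + toℕ r) % N      ≡⟨ toℕ-mod _ N ⟨
      toℕ (addMod N (lowDigit i) r)       ∎

derived-tower : (X : Graph) {M N K : ℕ} .{{_ : NonZero M}} .{{_ : NonZero N}} .{{_ : NonZero K}} →
  M ≡ K * N → (αM : E X → Fin M) (αN : E X → Fin N) (γ : E X × Fin N → Fin K) →
  (∀ e → toℕ (αN e) ≡ toℕ (αM e) % N) →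
  (∀ e s → toℕ (γ (e , s)) ≡ (toℕ s + toℕ (αM e)) / N % K) →
  GraphIso (derived X M αM) (derived (derived X N αN) K γ)
derived-tower X {N = N} {K} refl αM αN γ αN≡αM%N γ≡carry = record
  { onV      = splitDigits
  ; onE      = splitDigits
  ; pres-src = λ _ → refl
  ; pres-tgt = λ (e , i) → cong (λ (q , r) → (tgt X e , r) , q) (addVoltage e i)
  ; pres-inv = λ (e , i) → cong (λ (q , r) → (inv X e , r) , q) (addVoltage e i)
  }
  where
  open Digits {K} {N}
  addVoltage : ∀ e i → remQuot N (addMod (K * N) i (αM e))
                   ≡ (addMod K (highDigit i) (γ (e , lowDigit i)) , addMod N (lowDigit i) (αN e))
  addVoltage e i = remQuot-addMod i (αM e) (αN e) (γ (e , lowDigit i)) (αN≡αM%N e) (γ≡carry e (lowDigit i))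

module PAdic (p : ℕ) .{{_ : NonZero p}} where

  -- Instance search cannot find NonZero (p ^ k) for a variable k, hence this
  -- operator in statements and the local instance declarations in proofs.
  infixl 7 _%p^_

  _%p^_ : ℕ → ℕ → ℕ
  x %p^ k = _%_ x (p ^ k) {{powNZ p k}}

  p^-split : ∀ {k j} → k ≤ j → p ^ j ≡ p ^ (j ∸ k) * p ^ k
  p^-split {k} {j} k≤j = begin
    p ^ j               ≡⟨ cong (p ^_) (m∸n+n≡m k≤j) ⟨
    p ^ (j ∸ k + k)     ≡⟨ ^-distribˡ-+-* p (j ∸ k) k ⟩
    p ^ (j ∸ k) * p ^ k ∎

  p^-∣ : ∀ {k j} → k ≤ j → p ^ k ∣ p ^ j
  p^-∣ {k} {j} k≤j = divides (p ^ (j ∸ k)) (p^-split k≤j)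

  %p^-%p^ : ∀ x {k j} → k ≤ j → x %p^ j %p^ k ≡ x %p^ k
  %p^-%p^ x {k} {j} k≤j = m∣n⇒o%n%m≡o%m (p ^ k) (p ^ j) x (p^-∣ k≤j)
    where
    instance
      _ = powNZ p k
      _ = powNZ p j

  res-% : (x : ℤₚ p) → ∀ {k j} → k ≤ j → toℕ (res x k) ≡ toℕ (res x j) %p^ k
  res-% x {k} {j} k≤j =
    subst (λ i → toℕ (res x k) ≡ toℕ (res x i) %p^ k) (m∸n+n≡m k≤j) (res-%-+ (j ∸ k))
    where
    res-%-+ : ∀ d → toℕ (res x k) ≡ toℕ (res x (d + k)) %p^ k
    res-%-+ zero    = sym (m<n⇒m%n≡m (toℕ<n (res x k)))
      where instance _ = powNZ p k
    res-%-+ (suc d) = begin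
      toℕ (res x k)                             ≡⟨ res-%-+ d ⟩
      toℕ (res x (d + k)) %p^ k                 ≡⟨ cong (_%p^ k) (compat x (d + k)) ⟩
      toℕ (res x (suc d + k)) %p^ (d + k) %p^ k ≡⟨ %p^-%p^ _ (m≤n+m k d) ⟩
      toℕ (res x (suc d + k)) %p^ k             ∎

  +-res-% : ∀ s (x : ℤₚ p) {k j} → k ≤ j → (s + toℕ (res x j)) %p^ k ≡ (s + toℕ (res x k)) %p^ k
  +-res-% s x {k} {j} k≤j = begin
    (s + toℕ (res x j)) %p^ k       ≡⟨ [m+n%d]%d≡[m+n]%d s (toℕ (res x j)) (p ^ k) ⟨
    (s + toℕ (res x j) %p^ k) %p^ k ≡⟨ cong (λ t → (s + t) %p^ k) (res-% x k≤j) ⟨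
    (s + toℕ (res x k)) %p^ k       ∎
    where instance _ = powNZ p k

  neg-∣ : ∀ x y → IsNeg y x → ∀ j → p ^ j ∣ toℕ (res y j) + toℕ (res x j)
  neg-∣ x y y≡-x j = m%n≡0⇒n∣m _ (p ^ j) (trans (sym (toℕ-mod _ (p ^ j))) (y≡-x j))
    where instance _ = powNZ p j

  fromCompatible : (f : ℕ → ℕ) → (∀ k → f k %p^ k ≡ f (suc k) %p^ k) → ℤₚ p
  res (fromCompatible f _) k = _mod_ (f k) (p ^ k) {{powNZ p k}}
  compat (fromCompatible f f-compat) k = begin
    toℕ (f k mod p ^ k)                 ≡⟨ toℕ-mod (f k) (p ^ k) ⟩
    f k %p^ k                           ≡⟨ f-compat k ⟩
    f (suc k) %p^ k                     ≡⟨ %p^-%p^ (f (suc k)) (n≤1+n k) ⟨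
    f (suc k) %p^ suc k %p^ k           ≡⟨ cong (_%p^ k) (toℕ-mod (f (suc k)) (p ^ suc k)) ⟨
    toℕ (f (suc k) mod p ^ suc k) %p^ k ∎
    where
    instance
      _ = powNZ p k
      _ = powNZ p (suc k)

  module _ (n : ℕ) where

    private instance
      _ = powNZ p n

    carryAt : Fin (p ^ n) → ℤₚ p → ℕ → ℕ
    carryAt s x j = (toℕ s + toℕ (res x j)) / p ^ n

    carryAt-% : ∀ s x {k j} → k + n ≤ j → carryAt s x j %p^ k ≡ carryAt s x (k + n) %p^ k
    carryAt-% s x {k} k+n≤j = /-%-cong (p ^ k) (p ^ n) (^-distribˡ-+-* p k n) (+-res-% (toℕ s) x k+n≤j)
      where
      instance
        _ = powNZ p k
        _ = powNZ p (k + n)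

    carryAt-*-+ : ∀ s x {j} → n ≤ j →
                  carryAt s x j * p ^ n + (toℕ s + toℕ (res x n)) % p ^ n ≡ toℕ s + toℕ (res x j)
    carryAt-*-+ s x {j} n≤j = begin
      carryAt s x j * p ^ n + (toℕ s + toℕ (res x n)) % p ^ n
        ≡⟨ cong (carryAt s x j * p ^ n +_) (+-res-% (toℕ s) x n≤j) ⟨
      carryAt s x j * p ^ n + (toℕ s + toℕ (res x j)) % p ^ n
        ≡⟨ +-comm (carryAt s x j * p ^ n) _ ⟩
      (toℕ s + toℕ (res x j)) % p ^ n + carryAt s x j * p ^ n
        ≡⟨ m≡m%n+[m/n]*n (toℕ s + toℕ (res x j)) (p ^ n) ⟨
      toℕ s + toℕ (res x j) ∎

    -- roundDown s x = s + x − (s + x mod p^n); its residue modulo p^k is read off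
    -- level k + n of x, so that no case distinction between k < n and k ≥ n arises.
    roundDown : Fin (p ^ n) → ℤₚ p → ℤₚ p
    roundDown s x = fromCompatible (λ k → carryAt s x (k + n) * p ^ n) compatible
      where
      compatible : ∀ k → carryAt s x (k + n) * p ^ n %p^ k ≡ carryAt s x (suc k + n) * p ^ n %p^ k
      compatible k = m%d≡n%d⇒[m*o]%d≡[n*o]%d (p ^ n) (p ^ k) (sym (carryAt-% s x (n≤1+n (k + n))))
        where instance _ = powNZ p k

    toℕ-res-roundDown : ∀ s x k → toℕ (res (roundDown s x) k) ≡ carryAt s x (k + n) * p ^ n %p^ k
    toℕ-res-roundDown s x k = toℕ-mod _ (p ^ k)
      where instance _ = powNZ p k

    roundDown-inPowIdeal : ∀ s x → InPowIdeal n (roundDown s x)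
    roundDown-inPowIdeal s x = trans (toℕ-res-roundDown s x n) (m*n%n≡0 (carryAt s x (n + n)) (p ^ n))

    roundDown-shift : ∀ s x {m} → n ≤ m →
      toℕ (res (roundDown s x) m) / p ^ n %p^ (m ∸ n) ≡ carryAt s x m %p^ (m ∸ n)
    roundDown-shift s x {m} n≤m = begin
      toℕ (res (roundDown s x) m) / p ^ n % K ≡⟨ cong (λ t → t / p ^ n % K) (toℕ-res-roundDown s x m) ⟩
      carryAt s x (m + n) * p ^ n % p ^ m / p ^ n % K
        ≡⟨ cong (_% K) (m%n/o≡m/o%k (carryAt s x (m + n) * p ^ n) {k = K} {p ^ n} (p^-split n≤m)) ⟩
      carryAt s x (m + n) * p ^ n / p ^ n % K % K ≡⟨ m%n%n≡m%n _ K ⟩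
      carryAt s x (m + n) * p ^ n / p ^ n % K     ≡⟨ cong (_% K) (m*n/n≡m _ (p ^ n)) ⟩
      carryAt s x (m + n) % K                     ≡⟨ carryAt-% s x (+-monoˡ-≤ n (m∸n≤m m n)) ⟩
      carryAt s x (m ∸ n + n) % K                 ≡⟨ carryAt-% s x (≤-reflexive (m∸n+n≡m n≤m)) ⟨
      carryAt s x m % K                           ∎
      where
      K = p ^ (m ∸ n)
      instance
        _ = powNZ p m
        _ = powNZ p (m ∸ n)

    addMod-res-neg : ∀ s x y → IsNeg y x → (toℕ (addMod (p ^ n) s (res x n)) + toℕ (res y n)) % p ^ n ≡ toℕ s
    addMod-res-neg s x y y≡-x = begin
      (toℕ (addMod (p ^ n) s (res x n)) + y′) % p ^ n ≡⟨ cong (λ t → (t + y′) % p ^ n) (toℕ-mod _ (p ^ n)) ⟩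
      ((toℕ s + x′) % p ^ n + y′) % p ^ n             ≡⟨ cong (_% p ^ n) (+-comm _ y′) ⟩
      (y′ + (toℕ s + x′) % p ^ n) % p ^ n             ≡⟨ [m+n%d]%d≡[m+n]%d y′ (toℕ s + x′) (p ^ n) ⟩
      (y′ + (toℕ s + x′)) % p ^ n                     ≡⟨ cong (_% p ^ n) (shuffle y′ (toℕ s) x′) ⟩
      (toℕ s + (y′ + x′)) % p ^ n                     ≡⟨ %-remove-+ʳ (toℕ s) (neg-∣ x y y≡-x n) ⟩
      toℕ s % p ^ n                                   ≡⟨ m<n⇒m%n≡m (toℕ<n s) ⟩
      toℕ s                                           ∎
      where
      x′ = toℕ (res x n)
      y′ = toℕ (res y n)
      shuffle : ∀ a b c → a + (b + c) ≡ b + (a + c)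
      shuffle = solve-∀

    roundDown-neg : ∀ s x y → IsNeg y x → IsNeg (roundDown (addMod (p ^ n) s (res x n)) y) (roundDown s x)
    roundDown-neg s x y y≡-x k = begin
      toℕ (addMod (p ^ k) (res (roundDown s′ y) k) (res (roundDown s x) k))
        ≡⟨ toℕ-mod _ (p ^ k) ⟩
      (toℕ (res (roundDown s′ y) k) + toℕ (res (roundDown s x) k)) % p ^ k
        ≡⟨ cong₂ (λ a b → (a + b) % p ^ k) (toℕ-res-roundDown s′ y k) (toℕ-res-roundDown s x k) ⟩
      (carryAt s′ y j * p ^ n % p ^ k + carryAt s x j * p ^ n % p ^ k) % p ^ k
        ≡⟨ %-distribˡ-+ (carryAt s′ y j * p ^ n) _ (p ^ k) ⟨
      (carryAt s′ y j * p ^ n + carryAt s x j * p ^ n) % p ^ k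
        ≡⟨ cong (_% p ^ k) carries ⟩
      (toℕ (res y j) + toℕ (res x j)) % p ^ k
        ≡⟨ n∣m⇒m%n≡0 _ (p ^ k) (∣-trans (p^-∣ (m≤m+n k n)) (neg-∣ x y y≡-x j)) ⟩
      0 ∎
      where
      instance _ = powNZ p k
      j = k + n
      s′ = addMod (p ^ n) s (res x n)
      lift : ∀ t z {u} → (toℕ t + toℕ (res z n)) % p ^ n ≡ u →
             carryAt t z j * p ^ n + u ≡ toℕ t + toℕ (res z j)
      lift t z low≡u = trans (cong (carryAt t z j * p ^ n +_) (sym low≡u)) (carryAt-*-+ t z (m≤n+m n k))
      carries : carryAt s′ y j * p ^ n + carryAt s x j * p ^ n ≡ toℕ (res y j) + toℕ (res x j)
      carries = +-cancel-cross (carryAt s′ y j * p ^ n) (carryAt s x j * p ^ n) (toℕ s) (toℕ s′)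
        (toℕ (res y j)) (toℕ (res x j))
        (lift s′ y (addMod-res-neg s x y y≡-x)) (lift s x (sym (toℕ-mod _ (p ^ n))))

lemma4p5 : (p : ℕ) .{{_ : NonZero p}} → Prime p →
           (X : Graph) → IsUndirected X → IsFinite X → Connected X →
           (α : E X → ℤₚ p) → IsZpVoltage X α →
           (n : ℕ) →
           Σ (E (layer p X α n) → ℤₚ p) (λ β →
             (IsZpVoltage (layer p X α n) β × (∀ e → InPowIdeal n (β e))) ×
             (∀ (m : ℕ) → n ≤ m →
               GraphIso (layer p X α m)
                        (derived (layer p X α n) (p ^ (m ∸ n)) {{powNZ p (m ∸ n)}} (reduceShift p β n m))))
lemma4p5 p _ X _ _ _ α α-voltage n = β , (β-voltage , λ (e , s) → roundDown-inPowIdeal n s (α e)) , tower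
  where
  open PAdic p

  β : E (layer p X α n) → ℤₚ p
  β (e , s) = roundDown n s (α e)

  β-voltage : IsZpVoltage (layer p X α n) β
  β-voltage (e , s) = roundDown-neg n s (α e) (α (inv X e)) (α-voltage e)

  tower : ∀ m → n ≤ m → GraphIso (layer p X α m)
                          (derived (layer p X α n) (p ^ (m ∸ n)) {{powNZ p (m ∸ n)}} (reduceShift p β n m))
  tower m n≤m = derived-tower X (p^-split n≤m) (reduce α m) (reduce α n) (reduceShift p β n m)
    (λ e → res-% (α e) n≤m)
    (λ e s → trans (toℕ-mod _ (p ^ (m ∸ n))) (roundDown-shift n s (α e) n≤m))
    where
    instance
      _ = powNZ p m
      _ = powNZ p n
      _ = powNZ p (m ∸ n)
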